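{- Let $S$ be a string and $a, b$ characters with $a \neq b$, and let $x$ be a string. If $x \neq S$, $x \notin \mathsf{M}(aS)$, $x \in \mathsf{M}(S)$, and $x \in \mathsf{M}(bS)$, then $bx \notin \mathsf{M}(bS)$.
   Context: Strings are finite sequences of characters from an alphabet $\Sigma$; $\varepsilon$ is the empty string. For a string $T$, $\mathrm{Substr}(T)$ is its set of substrings (including $\varepsilon$). A substring $u$ of $T$ is left-maximal in $T$ if $u$ is a prefix of $T$ or there are distinct characters $c \neq d$ with $cu, du \in \mathrm{Substr}(T)$; it is right-maximal in $T$ if $u$ is a suffix of $T$ or there are distinct characters $c\neq d$ with $uc, ud \in \mathrm{Substr}(T)$. $\mathsf{M}(T)$ is the set of substrings of $T$ that are both left- and right-maximal. -}

module Defs where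

open import Data.List using (List; []; _∷_; _++_; [_])
open import Data.Product using (Σ; ∃; ∃-syntax; _×_; _,_)
open import Data.Sum using (_⊎_)
open import Relation.Binary.PropositionalEquality using (_≡_; _≢_)

module _ {Σc : Set} where

  Substr : List Σc → List Σc → Set
  Substr T u = ∃[ p ] ∃[ s ] T ≡ p ++ u ++ s

  IsPrefix : List Σc → List Σc → Set
  IsPrefix T u = ∃[ s ] T ≡ u ++ s

  IsSuffix : List Σc → List Σc → Set
  IsSuffix T u = ∃[ p ] T ≡ p ++ u

  LeftMax : List Σc → List Σc → Set
  LeftMax T u = Substr T u ×
    (IsPrefix T u ⊎ (∃[ c ] ∃[ d ] (c ≢ d × Substr T (c ∷ u) × Substr T (d ∷ u))))

  RightMax : List Σc → List Σc → Set
  RightMax T u = Substr T u ×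
    (IsSuffix T u ⊎ (∃[ c ] ∃[ d ] (c ≢ d × Substr T (u ++ [ c ]) × Substr T (u ++ [ d ]))))

  M : List Σc → List Σc → Set
  M T u = LeftMax T u × RightMax T u

-- If bx were in M(bS), its right-maximality together with x ≠ S would force bx to occur
-- inside S. Then x, already in M(S), would stay in M(aS): right-maximality survives
-- prepending a character, and left-maximality does too, since if x is a prefix of S
-- then ax and bx are two distinct left extensions of x in aS.
module Submission where

open import Defs
open import Data.List using (List; []; _∷_; _++_; [_])
open import Data.List.Properties using (++-assoc; ++-cancelˡ; ++-identityʳ; ∷-injectiveˡ; ∷-injectiveʳ)
open import Data.Product using (_,_; proj₂)
open import Data.Sum using (_⊎_; inj₁; inj₂)
open import Data.Empty using (⊥-elim)
open import Function using (_∘_)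
open import Relation.Binary.PropositionalEquality using (_≡_; _≢_; sym; trans; cong; module ≡-Reasoning)
open import Relation.Nullary using (¬_)

module _ {Σc : Set} where

  substr-cons : {T u : List Σc} (c : Σc) → Substr T u → Substr (c ∷ T) u
  substr-cons c (p , s , eq) = c ∷ p , s , cong (c ∷_) eq

  substr-uncons : {c : Σc} {T v : List Σc} → Substr (c ∷ T) v → IsPrefix (c ∷ T) v ⊎ Substr T v
  substr-uncons ([]    , s , eq) = inj₁ (s , eq)
  substr-uncons (_ ∷ p , s , eq) = inj₂ (p , s , ∷-injectiveʳ eq)

  substr-init : {T u : List Σc} {c : Σc} → Substr T (u ++ [ c ]) → Substr T u
  substr-init {u = u} {c} (p , s , eq) = p , c ∷ s , trans eq (cong (p ++_) (++-assoc u [ c ] s))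

  prefix-snoc-unique : {T v : List Σc} {c d : Σc} →
    IsPrefix T (v ++ [ c ]) → IsPrefix T (v ++ [ d ]) → c ≡ d
  prefix-snoc-unique {T} {v} {c} {d} (s , eq) (s′ , eq′) =
    ∷-injectiveˡ (++-cancelˡ v (c ∷ s) (d ∷ s′) (begin
      v ++ c ∷ s         ≡⟨ sym (++-assoc v [ c ] s) ⟩
      (v ++ [ c ]) ++ s  ≡⟨ sym eq ⟩
      T                  ≡⟨ eq′ ⟩
      (v ++ [ d ]) ++ s′ ≡⟨ ++-assoc v [ d ] s′ ⟩
      v ++ d ∷ s′        ∎))
    where open ≡-Reasoning

  -- Of two right extensions vc ≠ vd, at most one can start at the front of cT.
  rightMax-tail : {c : Σc} {T v : List Σc} → v ≢ c ∷ T → RightMax (c ∷ T) v → Substr T v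
  rightMax-tail v≢cT (_ , inj₁ ([] , eq)) = ⊥-elim (v≢cT (sym eq))
  rightMax-tail {v = v} _ (_ , inj₁ (_ ∷ p , eq)) =
    p , [] , trans (∷-injectiveʳ eq) (cong (p ++_) (sym (++-identityʳ v)))
  rightMax-tail _ (_ , inj₂ (c , d , c≢d , vc , vd)) with substr-uncons vc | substr-uncons vd
  ... | inj₂ vc∈T | _         = substr-init vc∈T
  ... | inj₁ _    | inj₂ vd∈T = substr-init vd∈T
  ... | inj₁ vc≤  | inj₁ vd≤  = ⊥-elim (c≢d (prefix-snoc-unique vc≤ vd≤))

  rightMax-cons : {T u : List Σc} (c : Σc) → RightMax T u → RightMax (c ∷ T) u
  rightMax-cons c (u∈T , inj₁ (p , eq)) = substr-cons c u∈T , inj₁ (c ∷ p , cong (c ∷_) eq)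
  rightMax-cons c (u∈T , inj₂ (d , e , d≢e , ud , ue)) =
    substr-cons c u∈T , inj₂ (d , e , d≢e , substr-cons c ud , substr-cons c ue)

  leftMax-cons : {T u : List Σc} {a b : Σc} → a ≢ b → Substr T (b ∷ u) → LeftMax T u → LeftMax (a ∷ T) u
  leftMax-cons {a = a} {b} a≢b bu∈T (u∈T , inj₁ (s , eq)) =
    substr-cons a u∈T , inj₂ (a , b , a≢b , ([] , s , cong (a ∷_) eq) , substr-cons a bu∈T)
  leftMax-cons {a = a} _ _ (u∈T , inj₂ (c , d , c≢d , cu , du)) =
    substr-cons a u∈T , inj₂ (c , d , c≢d , substr-cons a cu , substr-cons a du)

lemma8 : {Σc : Set} (S : List Σc) (a b : Σc) (x : List Σc) →
    a ≢ b → x ≢ S → ¬ M (a ∷ S) x → M S x → M (b ∷ S) x →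
    ¬ M (b ∷ S) (b ∷ x)
lemma8 S a b x a≢b x≢S x∉M[aS] (x-left , x-right) _ (_ , bx-right) =
  x∉M[aS] (leftMax-cons a≢b bx∈S x-left , rightMax-cons a x-right)
  where
  bx∈S : Substr S (b ∷ x)
  bx∈S = rightMax-tail (x≢S ∘ ∷-injectiveʳ) bx-right
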